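{- Let $t,s$ be positive integers and $n=ts$. Then there exists a $(t\mid ts^2)$-cointersection representation of the complete bipartite graph $\mathcal{K}_{n,n}$. As a consequence, $\theta^{c}(\mathcal{K}_{n,n})=2n=2\sqrt{\theta_1(\mathcal{K}_{n,n})}$ for every positive integer $n$.
   Context: Graphs are finite, simple and undirected. For a graph $\mathcal{G}=(\mathcal{V},\mathcal{E})$ and positive integers $\alpha,\beta$, an $(\alpha\mid\beta)$-cointersection representation (CIR) of $\mathcal{G}$ consists of two disjoint finite sets of features $\mathcal{A},\mathcal{B}$ with $|\mathcal{A}|=\alpha$, $|\mathcal{B}|=\beta$, together with an assignment to each vertex $v$ of subsets $A_v\subseteq\mathcal{A}$, $B_v\subseteq\mathcal{B}$ (possibly empty), such that for all distinct $u,v\in\mathcal{V}$: $(u,v)\in\mathcal{E}$ if and only if $A_u\cap A_v\neq\varnothing$ and $B_u\cap B_v\neq\varnothing$. The cointersection number $\theta^{c}(\mathcal{G})$ is the minimum of $\alpha+\beta$ over all CIRs of $\mathcal{G}$. The intersection number $\theta_1(\mathcal{G})$ of a graph with at least one edge is the minimum number of cliques of $\mathcal{G}$ needed to cover all its edges. -}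

module Defs where

open import Data.Nat using (ℕ; _+_; _≤_; _<ᵇ_)
open import Data.Bool using (Bool; true; false; _xor_)
open import Data.Bool.Properties using (xor-same; xor-comm)
open import Data.Fin using (Fin; toℕ)
open import Data.Fin.Subset using (Subset; _∈_; _∩_; Nonempty)
open import Data.Vec using (Vec; lookup)
open import Data.Product using (_×_; Σ; ∃; ∃-syntax)
open import Data.Empty using (⊥)
open import Relation.Nullary using (¬_)
open import Relation.Binary.PropositionalEquality using (_≡_; _≢_)
open import Function.Bundles using (_⇔_)

record Graph (N : ℕ) : Set where
  field
    adj    : Fin N → Fin N → Bool
    sym    : ∀ u v → adj u v ≡ adj v u
    irrefl : ∀ v → adj v v ≡ false

open Graph public

-- An (α | β)-cointersection representation of G.
-- Feature sets: 𝒜 = Fin α, ℬ = Fin β (disjoint by construction, being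
-- distinct types); each vertex v gets A v ⊆ 𝒜 and B v ⊆ ℬ.
record CIR {N : ℕ} (α β : ℕ) (G : Graph N) : Set where
  field
    A   : Fin N → Subset α
    B   : Fin N → Subset β
    rep : ∀ u v → u ≢ v →
          (adj G u v ≡ true ⇔ (Nonempty (A u ∩ A v) × Nonempty (B u ∩ B v)))

IsCointersectionNumber : {N : ℕ} → Graph N → ℕ → Set
IsCointersectionNumber G k =
  (∃[ α ] ∃[ β ] (1 ≤ α × 1 ≤ β × α + β ≡ k × CIR α β G))
  × (∀ α β → 1 ≤ α → 1 ≤ β → CIR α β G → k ≤ α + β)

IsClique : {N : ℕ} → Graph N → Subset N → Set
IsClique G C = ∀ u v → u ∈ C → v ∈ C → u ≢ v → adj G u v ≡ true

record EdgeCliqueCover {N : ℕ} (G : Graph N) (k : ℕ) : Set where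
  field
    cliques   : Vec (Subset N) k
    areCliques : ∀ i → IsClique G (lookup cliques i)
    covers    : ∀ u v → adj G u v ≡ true →
                ∃[ i ] (u ∈ lookup cliques i × v ∈ lookup cliques i)

HasEdge : {N : ℕ} → Graph N → Set
HasEdge G = ∃[ u ] ∃[ v ] (adj G u v ≡ true)

IsIntersectionNumber : {N : ℕ} → Graph N → ℕ → Set
IsIntersectionNumber G k =
  EdgeCliqueCover G k × (∀ m → EdgeCliqueCover G m → k ≤ m)

side : (n : ℕ) → Fin (n + n) → Bool
side n v = toℕ v <ᵇ n

K : (n : ℕ) → Graph (n + n)
K n = record
  { adj    = λ u v → side n u xor side n v
  ; sym    = λ u v → xor-comm (side n u) (side n v)
  ; irrefl = λ v → xor-same (side n v)
  }

module Submission where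

-- Write the vertices of K_n as left vertices p ↑ˡ n and right vertices n ↑ʳ q.
-- (1) Bipartite criterion: giving each left and each right vertex a pair of
--     feature sets, such that every left/right pair meets in both coordinates
--     while two distinct vertices on the same side never do, is a CIR of K_n.
-- (2) Construction (n = ts): a right vertex is a pair (i, j) ∈ [t] × [s] and a
--     B-feature is a pair (p, j) ∈ [ts] × [s].  Left vertex p gets A = [t] and
--     B = {(p, ·)}; right vertex (i, j) gets A = {i} and B = {(·, j)}.
--     This satisfies (1), giving a (t | ts²)-CIR.  With s = 1 it is an (n | n)-CIR.
-- (3) Every (α | β)-CIR of a graph G yields an edge clique cover of G with
--     α β cliques: for each (a, b), the vertices carrying both a and b.
-- (4) Every edge clique cover of K_n has at least n² cliques, because a clique
--     contains at most one vertex of each side, so the n² edges need distinct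
--     cliques.
-- (5) AM-GM in ℕ: n² ≤ αβ implies 2n ≤ α + β.
-- Then θ₁(K_n) = n² by (2)+(3) and (4), and θᶜ(K_n) = 2n by (2) and (3)+(4)+(5).

open import Defs
open import Data.Nat using (ℕ; _*_; _≤_)
open import Data.Product using (_×_)

open import Data.Nat using (suc; _+_; _<_; z≤n; s≤s)
open import Data.Nat.Properties
  using (≤-total; m≤m+n; +-identityʳ; ≤⇒≯; ≮⇒≥; *-comm; +-comm; *-identityʳ; *-mono-<; *-monoʳ-≤;
         <-irrefl; <⇒<ᵇ; <ᵇ⇒<; m≤n⇒∃[o]m+o≡n; module ≤-Reasoning)
open import Data.Nat.Tactic.RingSolver using (solve-∀)
open import Data.Bool using (true; false; _xor_)
open import Data.Bool.Properties using (T-≡; ¬-not)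
open import Data.Fin using (Fin; zero; toℕ; _↑ˡ_; _↑ʳ_; splitAt; join; remQuot; combine)
open import Data.Fin.Properties
  using (_≟_; toℕ-↑ˡ; toℕ-↑ʳ; ↑ˡ-injective; ↑ʳ-injective; splitAt-↑ˡ; splitAt-↑ʳ;
         join-splitAt; remQuot-combine; combine-remQuot; injective⇒≤; toℕ<n)
open import Data.Fin.Subset using (Subset; _∈_; _∩_; Nonempty; ⊤; ⁅_⁆)
open import Data.Fin.Subset.Properties using (x∈p∩q⁺; x∈p∩q⁻; ∈⊤; x∈⁅x⁆; x∈⁅y⁆⇒x≡y; x∈⁅y⁆⇔x≡y)
open import Data.Vec using (Vec; lookup; tabulate)
open import Data.Vec.Properties using ([]=⇒lookup; lookup⇒[]=; lookup∘tabulate)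
open import Data.Product using (∃-syntax; _,_; proj₁; proj₂; uncurry)
open import Data.Sum using (_⊎_; inj₁; inj₂; [_,_]′)
open import Data.Empty using (⊥-elim)
open import Relation.Nullary using (yes; no)
open import Relation.Binary.PropositionalEquality
  using (_≡_; _≢_; refl; trans; cong; cong₂; subst; subst₂; module ≡-Reasoning)
  renaming (sym to ≡-sym)
open import Function using (_∘_)
open import Function.Bundles using (_⇔_; mk⇔; Equivalence)

private
  variable
    m k N α β : ℕ

-- The subset { x | g x ∈ S x } of Fin m; fibres of maps and "the vertices
-- carrying a feature" are both of this form.
select : (Fin m → Subset k) → (Fin m → Fin k) → Subset m
select S g = tabulate λ x → lookup (S x) (g x)

∈-select : ∀ (S : Fin m → Subset k) g x → x ∈ select S g ⇔ g x ∈ S x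
∈-select S g x = mk⇔
  (λ x∈ → lookup⇒[]= (g x) (S x) (trans (≡-sym (lookup∘tabulate _ x)) ([]=⇒lookup x∈)))
  (λ gx∈ → lookup⇒[]= x _ (trans (lookup∘tabulate _ x) ([]=⇒lookup gx∈)))

fibre : (Fin m → Fin k) → Fin k → Subset m
fibre f a = select (λ _ → ⁅ a ⁆) f

∈-fibre⁺ : ∀ (f : Fin m → Fin k) {a} x → f x ≡ a → x ∈ fibre f a
∈-fibre⁺ f {a} x fx≡a =
  Equivalence.from (∈-select (λ _ → ⁅ a ⁆) f x) (Equivalence.from x∈⁅y⁆⇔x≡y fx≡a)

∈-fibre⁻ : ∀ (f : Fin m → Fin k) {a} x → x ∈ fibre f a → f x ≡ a
∈-fibre⁻ f {a} x x∈ = x∈⁅y⁆⇒x≡y a (Equivalence.to (∈-select (λ _ → ⁅ a ⁆) f x) x∈)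

remQuot-injective : ∀ (e e' : Fin (m * k)) → remQuot {m} k e ≡ remQuot {m} k e' → e ≡ e'
remQuot-injective {m} {k} e e' eq = begin
  e                                   ≡⟨ ≡-sym (combine-remQuot {m} k e) ⟩
  uncurry combine (remQuot {m} k e)   ≡⟨ cong (uncurry combine) eq ⟩
  uncurry combine (remQuot {m} k e')  ≡⟨ combine-remQuot {m} k e' ⟩
  e'                                  ∎
  where open ≡-Reasoning

data View (n : ℕ) : Fin (n + n) → Set where
  left  : (p : Fin n) → View n (p ↑ˡ n)
  right : (q : Fin n) → View n (n ↑ʳ q)

view : ∀ n u → View n u
view n u = subst (View n) (join-splitAt n n u) (fromSplit (splitAt n u))
  where
  fromSplit : (x : Fin n ⊎ Fin n) → View n (join n n x)
  fromSplit (inj₁ p) = left p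
  fromSplit (inj₂ q) = right q

side-left : ∀ n (p : Fin n) → side n (p ↑ˡ n) ≡ true
side-left n p = Equivalence.to T-≡ (<⇒<ᵇ (subst (_< n) (≡-sym (toℕ-↑ˡ p n)) (toℕ<n p)))

side-right : ∀ n (q : Fin n) → side n (n ↑ʳ q) ≡ false
side-right n q = ¬-not λ eq →
  ≤⇒≯ (subst (n ≤_) (≡-sym (toℕ-↑ʳ n q)) (m≤m+n n (toℕ q)))
      (<ᵇ⇒< (toℕ (n ↑ʳ q)) n (Equivalence.from T-≡ eq))

adj-left-right : ∀ n (p q : Fin n) → adj (K n) (p ↑ˡ n) (n ↑ʳ q) ≡ true
adj-left-right n p q = cong₂ _xor_ (side-left n p) (side-right n q)

adj-right-left : ∀ n (q p : Fin n) → adj (K n) (n ↑ʳ q) (p ↑ˡ n) ≡ true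
adj-right-left n q p = cong₂ _xor_ (side-right n q) (side-left n p)

adj-left-left : ∀ n (p p' : Fin n) → adj (K n) (p ↑ˡ n) (p' ↑ˡ n) ≡ false
adj-left-left n p p' = cong₂ _xor_ (side-left n p) (side-left n p')

adj-right-right : ∀ n (q q' : Fin n) → adj (K n) (n ↑ʳ q) (n ↑ʳ q') ≡ false
adj-right-right n q q' = cong₂ _xor_ (side-right n q) (side-right n q')

Labels : ℕ → ℕ → Set
Labels α β = Subset α × Subset β

_⋈_ : Labels α β → Labels α β → Set
X ⋈ Y = Nonempty (proj₁ X ∩ proj₁ Y) × Nonempty (proj₂ X ∩ proj₂ Y)

⋈-sym : (X Y : Labels α β) → X ⋈ Y → Y ⋈ X
⋈-sym X Y ((a , a∈) , (b , b∈)) = (a , swap∈ a∈) , (b , swap∈ b∈)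
  where
  swap∈ : ∀ {n} {P Q : Subset n} {x} → x ∈ P ∩ Q → x ∈ Q ∩ P
  swap∈ {P = P} {Q} x∈ = x∈p∩q⁺ (proj₂ (x∈p∩q⁻ P Q x∈) , proj₁ (x∈p∩q⁻ P Q x∈))

false≢true : ∀ {b} → b ≡ false → b ≢ true
false≢true refl ()

bipartite-CIR : ∀ n (L R : Fin n → Labels α β) →
                (∀ p q → L p ⋈ R q) →
                (∀ p p' → L p ⋈ L p' → p ≡ p') →
                (∀ q q' → R q ⋈ R q' → q ≡ q') →
                CIR α β (K n)
bipartite-CIR {α} {β} n L R cross left-apart right-apart = record
  { A   = proj₁ ∘ label
  ; B   = proj₂ ∘ label
  ; rep = λ u v u≢v → represents (view n u) (view n v) u≢v
  }
  where
  label : Fin (n + n) → Labels α β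
  label u = [ L , R ]′ (splitAt n u)

  label-left : ∀ p → label (p ↑ˡ n) ≡ L p
  label-left p = cong [ L , R ]′ (splitAt-↑ˡ n p n)

  label-right : ∀ q → label (n ↑ʳ q) ≡ R q
  label-right q = cong [ L , R ]′ (splitAt-↑ʳ n n q)

  represents : ∀ {u v} → View n u → View n v → u ≢ v →
               adj (K n) u v ≡ true ⇔ label u ⋈ label v
  represents (left p) (left p') p≢p'
    rewrite label-left p | label-left p' = mk⇔
      (⊥-elim ∘ false≢true (adj-left-left n p p'))
      (⊥-elim ∘ p≢p' ∘ cong (_↑ˡ n) ∘ left-apart p p')
  represents (left p) (right q) _
    rewrite label-left p | label-right q = mk⇔
      (λ _ → cross p q) (λ _ → adj-left-right n p q)
  represents (right q) (left p) _
    rewrite label-right q | label-left p = mk⇔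
      (λ _ → ⋈-sym (L p) (R q) (cross p q)) (λ _ → adj-right-left n q p)
  represents (right q) (right q') q≢q'
    rewrite label-right q | label-right q' = mk⇔
      (⊥-elim ∘ false≢true (adj-right-right n q q'))
      (⊥-elim ∘ q≢q' ∘ cong (n ↑ʳ_) ∘ right-apart q q')

meet : ∀ {P Q : Subset m} x → x ∈ P → x ∈ Q → Nonempty (P ∩ Q)
meet x x∈P x∈Q = x , x∈p∩q⁺ (x∈P , x∈Q)

module Construction (t s : ℕ) where
  -- A right vertex q is the pair (row q , col q) ∈ Fin t × Fin s, and a
  -- B-feature y ∈ Fin (t s · s) is the pair (owner y , colour y) ∈ Fin (t s) × Fin s.
  row : Fin (t * s) → Fin t
  row q = proj₁ (remQuot {t} s q)

  col : Fin (t * s) → Fin s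
  col q = proj₂ (remQuot {t} s q)

  owner : Fin (t * s * s) → Fin (t * s)
  owner y = proj₁ (remQuot {t * s} s y)

  colour : Fin (t * s * s) → Fin s
  colour y = proj₂ (remQuot {t * s} s y)

  L : Fin (t * s) → Labels t (t * s * s)
  L p = ⊤ , fibre owner p

  R : Fin (t * s) → Labels t (t * s * s)
  R q = ⁅ row q ⁆ , fibre colour (col q)

  cross : ∀ p q → L p ⋈ R q
  cross p q = meet (row q) ∈⊤ (x∈⁅x⁆ (row q))
            , meet y (∈-fibre⁺ owner y owner-y) (∈-fibre⁺ colour y colour-y)
    where
    y : Fin (t * s * s)
    y = combine p (col q)
    owner-y : owner y ≡ p
    owner-y = cong proj₁ (remQuot-combine p (col q))
    colour-y : colour y ≡ col q
    colour-y = cong proj₂ (remQuot-combine p (col q))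

  -- Distinct left vertices own disjoint B-sets.
  left-apart : ∀ p p' → L p ⋈ L p' → p ≡ p'
  left-apart p p' (_ , (y , y∈)) =
    trans (≡-sym (∈-fibre⁻ owner y (proj₁ y∈both))) (∈-fibre⁻ owner y (proj₂ y∈both))
    where y∈both = x∈p∩q⁻ (fibre owner p) (fibre owner p') y∈

  -- Right vertices sharing an A-feature have the same row, and sharing a
  -- B-feature have the same column; hence they coincide.
  right-apart : ∀ q q' → R q ⋈ R q' → q ≡ q'
  right-apart q q' ((x , x∈) , (y , y∈)) = remQuot-injective {t} q q' (cong₂ _,_ same-row same-col)
    where
    x∈both = x∈p∩q⁻ ⁅ row q ⁆ ⁅ row q' ⁆ x∈
    y∈both = x∈p∩q⁻ (fibre colour (col q)) (fibre colour (col q')) y∈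
    same-row : row q ≡ row q'
    same-row = trans (≡-sym (x∈⁅y⁆⇒x≡y _ (proj₁ x∈both))) (x∈⁅y⁆⇒x≡y _ (proj₂ x∈both))
    same-col : col q ≡ col q'
    same-col = trans (≡-sym (∈-fibre⁻ colour y (proj₁ y∈both))) (∈-fibre⁻ colour y (proj₂ y∈both))

  cir : CIR t (t * s * s) (K (t * s))
  cir = bipartite-CIR (t * s) L R cross left-apart right-apart

module CliqueCoverOfCIR {G : Graph N} (ρ : CIR α β G) where
  open CIR ρ

  holders : ∀ {γ} → (Fin N → Subset γ) → Fin γ → Subset N
  holders F a = select F (λ _ → a)

  clique : Fin (α * β) → Subset N
  clique e = holders A (proj₁ (remQuot {α} β e)) ∩ holders B (proj₂ (remQuot {α} β e))

  cliques : Vec (Subset N) (α * β)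
  cliques = tabulate clique

  ∈-clique⁻ : ∀ e v → v ∈ lookup cliques e →
              proj₁ (remQuot {α} β e) ∈ A v × proj₂ (remQuot {α} β e) ∈ B v
  ∈-clique⁻ e v v∈ = Equivalence.to (∈-select A _ v) (proj₁ v∈both)
                   , Equivalence.to (∈-select B _ v) (proj₂ v∈both)
    where
    v∈both = x∈p∩q⁻ (holders A _) (holders B _) (subst (v ∈_) (lookup∘tabulate clique e) v∈)

  ∈-clique⁺ : ∀ a b v → a ∈ A v → b ∈ B v → v ∈ lookup cliques (combine a b)
  ∈-clique⁺ a b v a∈ b∈ =
    subst (v ∈_) (≡-sym (lookup∘tabulate clique (combine a b)))
      (subst (λ ab → v ∈ holders A (proj₁ ab) ∩ holders B (proj₂ ab))
             (≡-sym (remQuot-combine a b))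
             (x∈p∩q⁺ (Equivalence.from (∈-select A _ v) a∈ , Equivalence.from (∈-select B _ v) b∈)))

  -- Any two distinct members share the features a and b, hence are adjacent.
  are-cliques : ∀ e → IsClique G (lookup cliques e)
  are-cliques e u v u∈ v∈ u≢v = Equivalence.from (rep u v u≢v)
    ( meet _ (proj₁ (∈-clique⁻ e u u∈)) (proj₁ (∈-clique⁻ e v v∈))
    , meet _ (proj₂ (∈-clique⁻ e u u∈)) (proj₂ (∈-clique⁻ e v v∈)) )

  -- An edge uv is witnessed by common features a, b; the clique (a , b) covers it.
  covers : ∀ u v → adj G u v ≡ true → ∃[ e ] (u ∈ lookup cliques e × v ∈ lookup cliques e)
  covers u v uv with Equivalence.to (rep u v u≢v) uv
    where
    u≢v : u ≢ v
    u≢v refl = false≢true (irrefl G u) uv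
  ... | (a , a∈) , (b , b∈) =
    let a∈Au , a∈Av = x∈p∩q⁻ (A u) (A v) a∈
        b∈Bu , b∈Bv = x∈p∩q⁻ (B u) (B v) b∈
    in combine a b , ∈-clique⁺ a b u a∈Au b∈Bu , ∈-clique⁺ a b v a∈Av b∈Bv

  cover : EdgeCliqueCover G (α * β)
  cover = record { cliques = cliques ; areCliques = are-cliques ; covers = covers }

clique-non-adjacent : ∀ (G : Graph N) C → IsClique G C →
                      ∀ u v → u ∈ C → v ∈ C → adj G u v ≡ false → u ≡ v
clique-non-adjacent G C is-clique u v u∈ v∈ ¬uv with u ≟ v
... | yes u≡v = u≡v
... | no u≢v  = ⊥-elim (false≢true ¬uv (is-clique u v u∈ v∈ u≢v))

module CliqueCoverOfK {n k : ℕ} (C : EdgeCliqueCover (K n) k) where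
  open EdgeCliqueCover C

  edge-clique : Fin n → Fin n → Fin k
  edge-clique i j = proj₁ (covers (i ↑ˡ n) (n ↑ʳ j) (adj-left-right n i j))

  -- Its clique contains exactly one left and one right vertex, so the edge
  -- is recovered from the clique.
  edge-clique-injective : ∀ i j i' j' → edge-clique i j ≡ edge-clique i' j' → i ≡ i' × j ≡ j'
  edge-clique-injective i j i' j' same
    with covers (i ↑ˡ n) (n ↑ʳ j) (adj-left-right n i j)
       | covers (i' ↑ˡ n) (n ↑ʳ j') (adj-left-right n i' j')
  ... | c , i∈ , j∈ | c' , i'∈ , j'∈ =
      ↑ˡ-injective n i i' (coincide i∈ i'∈ (adj-left-left n i i'))
    , ↑ʳ-injective n j j' (coincide j∈ j'∈ (adj-right-right n j j'))
    where
    coincide : ∀ {u v} → u ∈ lookup cliques c → v ∈ lookup cliques c' →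
               adj (K n) u v ≡ false → u ≡ v
    coincide {u} {v} u∈ v∈ =
      clique-non-adjacent (K n) _ (areCliques c) u v u∈
        (subst (λ z → v ∈ lookup cliques z) (≡-sym same) v∈)

  -- The n² pairs (i , j) ≅ Fin (n * n) inject into the k cliques.
  lower-bound : n * n ≤ k
  lower-bound = injective⇒≤ {f = uncurry edge-clique ∘ remQuot n} λ {e} {e'} same →
    let i≡i' , j≡j' = edge-clique-injective _ _ _ _ same
    in remQuot-injective {n} e e' (cong₂ _,_ i≡i' j≡j')

-- (5) AM-GM in ℕ.  First 4ab ≤ (a + b)², for a ≤ b writing b = a + d.
four-mul≤square-ordered : ∀ {a b} → a ≤ b → 4 * (a * b) ≤ (a + b) * (a + b)
four-mul≤square-ordered {a} a≤b with d , refl ← m≤n⇒∃[o]m+o≡n a≤b = begin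
  4 * (a * (a + d))                    ≤⟨ m≤m+n _ (d * d) ⟩
  4 * (a * (a + d)) + d * d            ≡⟨ square-expansion a d ⟩
  (a + (a + d)) * (a + (a + d))        ∎
  where
  open ≤-Reasoning
  square-expansion : ∀ a d → 4 * (a * (a + d)) + d * d ≡ (a + (a + d)) * (a + (a + d))
  square-expansion = solve-∀

four-mul≤square : ∀ a b → 4 * (a * b) ≤ (a + b) * (a + b)
four-mul≤square a b with ≤-total a b
... | inj₁ a≤b = four-mul≤square-ordered a≤b
... | inj₂ b≤a = subst₂ (λ x y → 4 * x ≤ y * y) (*-comm b a) (+-comm b a)
                        (four-mul≤square-ordered b≤a)

amgm : ∀ n a b → n * n ≤ a * b → 2 * n ≤ a + b
amgm n a b n²≤ab = ≮⇒≥ λ a+b<2n → <-irrefl refl (begin-strict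
  (a + b) * (a + b)    <⟨ *-mono-< a+b<2n a+b<2n ⟩
  (2 * n) * (2 * n)    ≡⟨ square-double n ⟩
  4 * (n * n)          ≤⟨ *-monoʳ-≤ 4 n²≤ab ⟩
  4 * (a * b)          ≤⟨ four-mul≤square a b ⟩
  (a + b) * (a + b)    ∎)
  where
  open ≤-Reasoning
  square-double : ∀ n → (2 * n) * (2 * n) ≡ 4 * (n * n)
  square-double = solve-∀

square-CIR : ∀ n → CIR n n (K n)
square-CIR n =
  subst (λ x → CIR n x (K n)) n·1≡n
    (subst (λ x → CIR n (x * 1) (K x)) n·1≡n (Construction.cir n 1))
  where
  n·1≡n : n * 1 ≡ n
  n·1≡n = *-identityʳ n

double : ∀ n → n + n ≡ 2 * n
double n = cong (n +_) (≡-sym (+-identityʳ n))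

proposition3 :
    (∀ (t s : ℕ) → 1 ≤ t → 1 ≤ s → CIR t (t * s * s) (K (t * s)))
    × (∀ (n : ℕ) → 1 ≤ n →
         HasEdge (K n)
         × IsCointersectionNumber (K n) (2 * n)
         × IsIntersectionNumber (K n) (n * n))
proposition3 = (λ t s _ _ → Construction.cir t s) , numbers
  where
  numbers : ∀ n → 1 ≤ n → HasEdge (K n) × IsCointersectionNumber (K n) (2 * n)
                                       × IsIntersectionNumber (K n) (n * n)
  numbers n@(suc _) _ =
      (zero ↑ˡ n , n ↑ʳ zero , adj-left-right n zero zero)
    , ( (n , n , s≤s z≤n , s≤s z≤n , double n , square-CIR n)
      , λ α β _ _ ρ → amgm n α β (CliqueCoverOfK.lower-bound (CliqueCoverOfCIR.cover ρ)) )
    , ( CliqueCoverOfCIR.cover (square-CIR n)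
      , λ _ C → CliqueCoverOfK.lower-bound C )
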